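{- Let $(\mathcal{G}_n)_{n\ge1}$ be the pseudofractal scale-free web. For every $n\geq 2$, the largest cardinality of an independent set of $\mathcal{G}_n$ that contains exactly one hub vertex equals $3^{n-1}-2^{n-1}+1$.
   Context: The pseudofractal scale-free web is the sequence of simple graphs $\mathcal{G}_n$, $n\ge 1$, defined by: $\mathcal{G}_1$ is a triangle; for $n>1$, $\mathcal{G}_n$ is obtained from $\mathcal{G}_{n-1}$ by adding, for every edge $(u,v)$ of $\mathcal{G}_{n-1}$, a new vertex adjacent to exactly $u$ and $v$. The hub vertices of $\mathcal{G}_n$ are the three vertices of the initial triangle $\mathcal{G}_1$. An independent set is a set of pairwise non-adjacent vertices. -}

module Defs where

open import Data.Nat using (ℕ; zero; suc; pred)
open import Data.Fin using (Fin; zero; suc)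
open import Data.Bool using (Bool; true; false)
open import Data.Sum using (_⊎_; inj₁; inj₂)
open import Data.Product using (Σ; _×_; _,_; proj₁; proj₂)
open import Data.List using (List; length)
open import Data.List.Membership.Propositional using (_∈_)
open import Data.List.Relation.Unary.Unique.Propositional using (Unique)
open import Relation.Binary.PropositionalEquality using (_≡_)
open import Relation.Nullary using (¬_)

-- Internal generation index m : the graph G_{m+1} of the paper.
-- Edges of generation m.
--   generation 0 (triangle): three edges {h0,h1}, {h1,h2}, {h0,h2}
--   generation m+1: every old edge e of generation m is kept (inj₁ e),
--   and the new vertex w_e attached to e gives two new edges
--   (inj₂ (e , false)) = {w_e, first end of e}, (inj₂ (e , true)) = {w_e, second end of e}.
Edge : ℕ → Set
Edge zero    = Fin 3
Edge (suc m) = Edge m ⊎ (Edge m × Bool)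

-- Vertices of generation m: the hubs at generation 0; at generation m+1
-- the old vertices (inj₁) plus one new vertex per edge of generation m (inj₂).
Vert : ℕ → Set
Vert zero    = Fin 3
Vert (suc m) = Vert m ⊎ Edge m

ends : (m : ℕ) → Edge m → Vert m × Vert m
ends zero zero             = zero , suc zero
ends zero (suc zero)       = suc zero , suc (suc zero)
ends zero (suc (suc zero)) = zero , suc (suc zero)
ends (suc m) (inj₁ e) = inj₁ (proj₁ (ends m e)) , inj₁ (proj₂ (ends m e))
ends (suc m) (inj₂ (e , false)) = inj₂ e , inj₁ (proj₁ (ends m e))
ends (suc m) (inj₂ (e , true))  = inj₂ e , inj₁ (proj₂ (ends m e))

AdjG : (m : ℕ) → Vert m → Vert m → Set
AdjG m x y = Σ (Edge m) λ e → (ends m e ≡ (x , y)) ⊎ (ends m e ≡ (y , x))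

hubG : (m : ℕ) → Fin 3 → Vert m
hubG zero    i = i
hubG (suc m) i = inj₁ (hubG m i)

-- Paper indexing: G_n for n ≥ 1 is generation n - 1.
-- (For n = 0, which the paper does not use, this is again the triangle.)
V : ℕ → Set
V n = Vert (pred n)

Adj : (n : ℕ) → V n → V n → Set
Adj n = AdjG (pred n)

hub : (n : ℕ) → Fin 3 → V n
hub n = hubG (pred n)

IsIndependentSet : (n : ℕ) → List (V n) → Set
IsIndependentSet n S =
  Unique S × (∀ x y → x ∈ S → y ∈ S → ¬ Adj n x y)

ExactlyOneHub : (n : ℕ) → List (V n) → Set
ExactlyOneHub n S = Σ (Fin 3) λ i → (hub n i ∈ S) × (∀ j → hub n j ∈ S → j ≡ i)

IsMaxOneHubIndep : (n : ℕ) → ℕ → Set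
IsMaxOneHubIndep n k =
  (Σ (List (V n)) λ S → IsIndependentSet n S × ExactlyOneHub n S × length S ≡ k)
  × (∀ S → IsIndependentSet n S → ExactlyOneHub n S → length S Data.Nat.≤ k)

-- Write G for generation k + 1 (the paper's G_{k+2}): its vertices are those of generation k
-- together with one new vertex w_e per edge e of generation k, adjacent exactly to the two
-- ends of e. Fix a hub h.
--
-- Upper bound: choose injectively an edge σ v at every old vertex v (incidentEdge). Sending
-- an old vertex v to σ v and a new vertex w_e to e is injective on an independent set S, since
-- w_{σ v} is adjacent to v. If h ∈ S, every other element of S is sent to an edge avoiding h:
-- w_e ∈ S forces e to avoid h, and an old v ∈ S with h an end of σ v would be adjacent to h.
-- Hence |S| ≤ 1 + #(edges avoiding h) = 1 + 3^{k+1} − 2^{k+1}, as there are 3^{k+1} edges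
-- and h has degree 2^{k+1}.
--
-- Lower bound: h together with all w_e for e avoiding h is independent of that size.

module Submission where

open import Defs
open import Data.Nat using (ℕ; zero; suc; _≤_; _+_; _*_; _∸_; _^_; z≤n; s≤s)
open import Data.Nat.Properties using (+-comm; +-identityʳ; m+n∸n≡m; ≤-trans; ≤-reflexive; module ≤-Reasoning)
open import Data.Nat.Tactic.RingSolver using (solve-∀)
open import Data.Fin using (Fin; zero; suc)
import Data.Fin.Properties as Fin
open import Data.Bool using (Bool; true; false; not)
import Data.Bool.Properties as Bool
open import Data.Sum using (_⊎_; inj₁; inj₂)
import Data.Sum.Properties as Sum
open Sum using (inj₁-injective; inj₂-injective)
open import Data.Product using (∃; _×_; _,_; proj₁; proj₂)
import Data.Product.Properties as Product
open import Data.List using (List; []; _∷_; _++_; map; length; [_])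
open import Data.List.Properties using (length-++; length-map)
open import Data.List.Membership.Propositional using (_∈_)
open import Data.List.Membership.Propositional.Properties using (∈-map⁺; ∈-map⁻; ∈-++⁺ˡ; ∈-++⁺ʳ; ∈-++⁻)
open import Data.List.Relation.Unary.Any using (here; there)
open import Data.List.Relation.Unary.All as All using (All; []; _∷_)
import Data.List.Relation.Unary.All.Properties as All
open import Data.List.Relation.Unary.AllPairs using ([]; _∷_)
open import Data.List.Relation.Unary.Unique.Propositional using (Unique)
import Data.List.Relation.Unary.Unique.Propositional.Properties as Unique
open import Data.List.Relation.Binary.Disjoint.Propositional using (Disjoint)
open import Data.List.Relation.Binary.Subset.Propositional using (_⊆_)
open import Data.Empty using (⊥-elim)
open import Relation.Binary.Definitions using (DecidableEquality)
open import Relation.Binary.PropositionalEquality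
  using (_≡_; _≢_; refl; sym; trans; cong; cong₂; subst; subst₂; module ≡-Reasoning)
open import Function using (_∘_)
open import Relation.Nullary using (¬_; yes; no)

module _ {A : Set} where

  ∈⇒∃-removal : ∀ {x : A} {ys} → x ∈ ys →
    ∃ λ zs → suc (length zs) ≡ length ys × (∀ {y} → y ∈ ys → y ≢ x → y ∈ zs)
  ∈⇒∃-removal {ys = y ∷ ys} (here refl) = ys , refl , keep
    where
    keep : ∀ {z} → z ∈ y ∷ ys → z ≢ y → z ∈ ys
    keep (here z≡y) z≢y = ⊥-elim (z≢y z≡y)
    keep (there z∈ys) _ = z∈ys
  ∈⇒∃-removal {ys = y ∷ ys} (there x∈ys) with ∈⇒∃-removal x∈ys
  ... | zs , len , keep = y ∷ zs , cong suc len , keep′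
    where
    keep′ : ∀ {z} → z ∈ y ∷ ys → z ≢ _ → z ∈ y ∷ zs
    keep′ (here z≡y)   _   = here z≡y
    keep′ (there z∈ys) z≢x = there (keep z∈ys z≢x)

  Unique-⊆⇒length-≤ : ∀ {xs ys : List A} → Unique xs → xs ⊆ ys → length xs ≤ length ys
  Unique-⊆⇒length-≤ []                       _  = z≤n
  Unique-⊆⇒length-≤ {x ∷ xs} (x∉xs ∷ xs-uniq) xs⊆ys with ∈⇒∃-removal (xs⊆ys (here refl))
  ... | zs , len , keep = subst (suc (length xs) ≤_) len (s≤s (Unique-⊆⇒length-≤ xs-uniq xs⊆zs))
    where
    xs⊆zs : xs ⊆ zs
    xs⊆zs y∈xs = keep (xs⊆ys (there y∈xs)) (λ y≡x → All.lookup x∉xs y∈xs (sym y≡x))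

  Disjoint-++ : ∀ {xs ys zs : List A} → Disjoint xs ys → Disjoint xs zs → Disjoint xs (ys ++ zs)
  Disjoint-++ {ys = ys} xs#ys xs#zs (v∈xs , v∈ys++zs) with ∈-++⁻ ys v∈ys++zs
  ... | inj₁ v∈ys = xs#ys (v∈xs , v∈ys)
  ... | inj₂ v∈zs = xs#zs (v∈xs , v∈zs)

  length-map-++ : ∀ {B : Set} (f : B → A) xs ys → length (map f xs ++ ys) ≡ length xs + length ys
  length-map-++ f xs ys = trans (length-++ (map f xs)) (cong (_+ length ys) (length-map f xs))

module _ {A B : Set} where

  Unique-map⁺-injectiveOn : ∀ (f : A → B) {xs} →
    (∀ {x y} → x ∈ xs → y ∈ xs → f x ≡ f y → x ≡ y) → Unique xs → Unique (map f xs)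
  Unique-map⁺-injectiveOn f inj []              = []
  Unique-map⁺-injectiveOn f inj (x∉xs ∷ xs-uniq) =
    All.map⁺ (All.tabulate λ y∈xs fx≡fy → All.lookup x∉xs y∈xs (inj (here refl) (there y∈xs) fx≡fy))
    ∷ Unique-map⁺-injectiveOn f (λ x∈ y∈ → inj (there x∈) (there y∈)) xs-uniq

  Disjoint-map : ∀ {C : Set} (f : A → C) (g : B → C) {xs ys} →
    (∀ {x y} → x ∈ xs → y ∈ ys → f x ≢ g y) → Disjoint (map f xs) (map g ys)
  Disjoint-map f g f≢g (fx∈ , gy∈) with ∈-map⁻ f fx∈ | ∈-map⁻ g gy∈
  ... | _ , x∈ , refl | _ , y∈ , eq = f≢g x∈ y∈ eq

end : ∀ k → Edge k → Bool → Vert k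
end k e false = proj₁ (ends k e)
end k e true  = proj₂ (ends k e)

end-old : ∀ k e b → end (suc k) (inj₁ e) b ≡ inj₁ (end k e b)
end-old k e false = refl
end-old k e true  = refl

end-new : ∀ k e b → end (suc k) (inj₂ (e , b)) true ≡ inj₁ (end k e b)
end-new k e false = refl
end-new k e true  = refl

ends-distinct : ∀ k e → end k e false ≢ end k e true
ends-distinct zero    zero               = λ ()
ends-distinct zero    (suc zero)         = λ ()
ends-distinct zero    (suc (suc zero))   = λ ()
ends-distinct (suc k) (inj₁ e)           = ends-distinct k e ∘ inj₁-injective
ends-distinct (suc k) (inj₂ (e , false)) = λ ()
ends-distinct (suc k) (inj₂ (e , true))  = λ ()

end-injective : ∀ k e {b c} → end k e b ≡ end k e c → b ≡ c
end-injective k e {false} {false} _ = refl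
end-injective k e {true}  {true}  _ = refl
end-injective k e {false} {true}  p = ⊥-elim (ends-distinct k e p)
end-injective k e {true}  {false} p = ⊥-elim (ends-distinct k e (sym p))

_≟ᵉ_ : ∀ {k} → DecidableEquality (Edge k)
_≟ᵉ_ {zero}  = Fin._≟_
_≟ᵉ_ {suc k} = Sum.≡-dec _≟ᵉ_ (Product.≡-dec _≟ᵉ_ Bool._≟_)

_≟ᵛ_ : ∀ {k} → DecidableEquality (Vert k)
_≟ᵛ_ {zero}  = Fin._≟_
_≟ᵛ_ {suc k} = Sum.≡-dec _≟ᵛ_ _≟ᵉ_

AdjG-irrefl : ∀ k x → ¬ AdjG k x x
AdjG-irrefl k x (e , inj₁ p) = ends-distinct k e (trans (cong proj₁ p) (sym (cong proj₂ p)))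
AdjG-irrefl k x (e , inj₂ p) = ends-distinct k e (trans (cong proj₁ p) (sym (cong proj₂ p)))

AdjG-sym : ∀ k {x y} → AdjG k x y → AdjG k y x
AdjG-sym k (e , inj₁ p) = e , inj₂ p
AdjG-sym k (e , inj₂ p) = e , inj₁ p

AdjG-old : ∀ k {x y} → AdjG k x y → AdjG (suc k) (inj₁ x) (inj₁ y)
AdjG-old k (e , inj₁ p) = inj₁ e , inj₁ (cong (λ (u , v) → inj₁ u , inj₁ v) p)
AdjG-old k (e , inj₂ p) = inj₁ e , inj₂ (cong (λ (u , v) → inj₁ u , inj₁ v) p)

AdjG-new-end : ∀ k e b → AdjG (suc k) (inj₂ e) (inj₁ (end k e b))
AdjG-new-end k e false = inj₂ (e , false) , inj₁ refl
AdjG-new-end k e true  = inj₂ (e , true)  , inj₁ refl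

AdjG-new⇒end : ∀ k e y → AdjG (suc k) y (inj₂ e) → ∃ λ b → y ≡ inj₁ (end k e b)
AdjG-new⇒end k e y (inj₂ (_ , false) , inj₂ refl) = false , refl
AdjG-new⇒end k e y (inj₂ (_ , true)  , inj₂ refl) = true  , refl
AdjG-new⇒end k e y (inj₁ _ , inj₁ ())
AdjG-new⇒end k e y (inj₁ _ , inj₂ ())
AdjG-new⇒end k e y (inj₂ (_ , false) , inj₁ ())
AdjG-new⇒end k e y (inj₂ (_ , true)  , inj₁ ())

ends-adjacent : ∀ k e b c → c ≡ b ⊎ AdjG k (end k e c) (end k e b)
ends-adjacent k e false false = inj₁ refl
ends-adjacent k e true  true  = inj₁ refl
ends-adjacent k e false true  = inj₂ (e , inj₂ refl)
ends-adjacent k e true  false = inj₂ (e , inj₁ refl)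

hubG-injective : ∀ k {i j} → hubG k j ≡ hubG k i → j ≡ i
hubG-injective zero    p = p
hubG-injective (suc k) p = hubG-injective k (inj₁-injective p)

incidentEdge : ∀ k → Vert k → Edge k
incidentEdge zero    v        = v
incidentEdge (suc k) (inj₁ v) = inj₁ (incidentEdge k v)
incidentEdge (suc k) (inj₂ e) = inj₂ (e , false)

incidentEdge-end : ∀ k v → ∃ λ c → end k (incidentEdge k v) c ≡ v
incidentEdge-end zero    zero             = false , refl
incidentEdge-end zero    (suc zero)       = false , refl
incidentEdge-end zero    (suc (suc zero)) = true  , refl
incidentEdge-end (suc k) (inj₁ v) with incidentEdge-end k v
... | c , p = c , trans (end-old k (incidentEdge k v) c) (cong inj₁ p)
incidentEdge-end (suc k) (inj₂ e) = false , refl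

incidentEdge-injective : ∀ k {u v} → incidentEdge k u ≡ incidentEdge k v → u ≡ v
incidentEdge-injective zero    p = p
incidentEdge-injective (suc k) {inj₁ _} {inj₁ _} p = cong inj₁ (incidentEdge-injective k (inj₁-injective p))
incidentEdge-injective (suc k) {inj₂ _} {inj₂ _} refl = refl

AdjG-new-incidentEdge : ∀ k v → AdjG (suc k) (inj₂ (incidentEdge k v)) (inj₁ v)
AdjG-new-incidentEdge k v with incidentEdge-end k v
... | c , p = subst (λ z → AdjG (suc k) (inj₂ (incidentEdge k v)) (inj₁ z)) p (AdjG-new-end k _ c)

hubIncidences : ∀ k → Fin 3 → List (Edge k × Bool)
hubIncidences zero zero             = (zero , false)     ∷ (suc (suc zero) , false) ∷ []
hubIncidences zero (suc zero)       = (zero , true)      ∷ (suc zero , false)       ∷ []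
hubIncidences zero (suc (suc zero)) = (suc zero , true)  ∷ (suc (suc zero) , true)  ∷ []
hubIncidences (suc k) i = map old I ++ map toNew I
  where
  I = hubIncidences k i
  old : Edge k × Bool → Edge (suc k) × Bool
  old (e , b) = inj₁ e , b
  toNew : Edge k × Bool → Edge (suc k) × Bool
  toNew (e , b) = inj₂ (e , b) , true

hubIncidences-sound : ∀ k i → All (λ (e , b) → end k e b ≡ hubG k i) (hubIncidences k i)
hubIncidences-sound zero zero             = refl ∷ refl ∷ []
hubIncidences-sound zero (suc zero)       = refl ∷ refl ∷ []
hubIncidences-sound zero (suc (suc zero)) = refl ∷ refl ∷ []
hubIncidences-sound (suc k) i = All.++⁺
  (All.map⁺ (All.map (λ { {e , b} p → trans (end-old k e b) (cong inj₁ p) }) (hubIncidences-sound k i)))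
  (All.map⁺ (All.map (λ { {e , b} p → trans (end-new k e b) (cong inj₁ p) }) (hubIncidences-sound k i)))

∈-hubIncidences : ∀ k i e b → end k e b ≡ hubG k i → (e , b) ∈ hubIncidences k i
∈-hubIncidences zero _ zero             false refl = here refl
∈-hubIncidences zero _ zero             true  refl = here refl
∈-hubIncidences zero _ (suc zero)       false refl = there (here refl)
∈-hubIncidences zero _ (suc zero)       true  refl = here refl
∈-hubIncidences zero _ (suc (suc zero)) false refl = there (here refl)
∈-hubIncidences zero _ (suc (suc zero)) true  refl = there (here refl)
∈-hubIncidences (suc k) i (inj₁ e) b p =
  ∈-++⁺ˡ (∈-map⁺ _ (∈-hubIncidences k i e b (inj₁-injective (trans (sym (end-old k e b)) p))))
∈-hubIncidences (suc k) i (inj₂ (e , b)) true p =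
  ∈-++⁺ʳ _ (∈-map⁺ _ (∈-hubIncidences k i e b (inj₁-injective (trans (sym (end-new k e b)) p))))
∈-hubIncidences (suc k) i (inj₂ (e , false)) false ()
∈-hubIncidences (suc k) i (inj₂ (e , true))  false ()

hubIncidences-unique : ∀ k i → Unique (hubIncidences k i)
hubIncidences-unique zero zero             = ((λ ()) ∷ []) ∷ [] ∷ []
hubIncidences-unique zero (suc zero)       = ((λ ()) ∷ []) ∷ [] ∷ []
hubIncidences-unique zero (suc (suc zero)) = ((λ ()) ∷ []) ∷ [] ∷ []
hubIncidences-unique (suc k) i = Unique.++⁺
  (Unique.map⁺ (λ { {_ , _} {_ , _} refl → refl }) (hubIncidences-unique k i))
  (Unique.map⁺ (λ { {_ , _} {_ , _} refl → refl }) (hubIncidences-unique k i))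
  (Disjoint-map _ _ (λ { {_ , _} {_ , _} _ _ () }))

length-hubIncidences : ∀ k i → length (hubIncidences k i) ≡ 2 ^ suc k
length-hubIncidences zero zero             = refl
length-hubIncidences zero (suc zero)       = refl
length-hubIncidences zero (suc (suc zero)) = refl
length-hubIncidences (suc k) i = begin
  length (hubIncidences (suc k) i)            ≡⟨ length-map-++ _ (hubIncidences k i) _ ⟩
  length (hubIncidences k i) + length (map _ (hubIncidences k i))
                                              ≡⟨ cong (length (hubIncidences k i) +_) (length-map _ (hubIncidences k i)) ⟩
  length (hubIncidences k i) + length (hubIncidences k i)
                                              ≡⟨ cong (λ d → d + d) (length-hubIncidences k i) ⟩
  2 ^ suc k + 2 ^ suc k                       ≡⟨ cong (2 ^ suc k +_) (sym (+-identityʳ _)) ⟩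
  2 ^ suc (suc k)                             ∎
  where open ≡-Reasoning

AvoidsHub : ∀ k → Fin 3 → Edge k → Set
AvoidsHub k i e = ∀ b → end k e b ≢ hubG k i

opposite : ∀ {k} → Edge k × Bool → Edge k × Bool
opposite (e , b) = e , not b

-- Besides the old edges avoiding the hub, a new edge avoids it if it joins w_e to an end of
-- an old edge e avoiding the hub, or to the far end of an old edge e at the hub.
avoidingEdges : ∀ k → Fin 3 → List (Edge k)
avoidingEdges zero zero             = [ suc zero ]
avoidingEdges zero (suc zero)       = [ suc (suc zero) ]
avoidingEdges zero (suc (suc zero)) = [ zero ]
avoidingEdges (suc k) i = map inj₁ A ++ map inj₂ (map (_, false) A ++ map (_, true) A ++ map opposite I)
  where
  A = avoidingEdges k i
  I = hubIncidences k i

AvoidsHub-new : ∀ k i e b → end k e b ≢ hubG k i → AvoidsHub (suc k) i (inj₂ (e , b))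
AvoidsHub-new k i e false _   false = λ ()
AvoidsHub-new k i e true  _   false = λ ()
AvoidsHub-new k i e b     e≢h true  = λ p → e≢h (inj₁-injective (trans (sym (end-new k e b)) p))

AvoidsHub-both : ∀ k i e b → end k e b ≢ hubG k i → end k e (not b) ≢ hubG k i → AvoidsHub k i e
AvoidsHub-both k i e false near far false = near
AvoidsHub-both k i e false near far true  = far
AvoidsHub-both k i e true  near far false = far
AvoidsHub-both k i e true  near far true  = near

avoidingEdges-sound : ∀ k i → All (AvoidsHub k i) (avoidingEdges k i)
avoidingEdges-sound zero zero             = (λ { false () ; true () }) ∷ []
avoidingEdges-sound zero (suc zero)       = (λ { false () ; true () }) ∷ []
avoidingEdges-sound zero (suc (suc zero)) = (λ { false () ; true () }) ∷ []
avoidingEdges-sound (suc k) i = All.++⁺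
  (All.map⁺ (All.map (λ {e} e-avoids b p → e-avoids b (inj₁-injective (trans (sym (end-old k e b)) p))) A-sound))
  (All.map⁺ (All.++⁺
    (All.map⁺ (All.map (λ {e} e-avoids → AvoidsHub-new k i e false (e-avoids false)) A-sound))
    (All.++⁺
      (All.map⁺ (All.map (λ {e} e-avoids → AvoidsHub-new k i e true (e-avoids true)) A-sound))
      (All.map⁺ (All.map (λ { {e , b} e-at-h → AvoidsHub-new k i e (not b) (far-end {e} {b} e-at-h) })
                         (hubIncidences-sound k i))))))
  where
  A-sound = avoidingEdges-sound k i
  far-end : ∀ {e b} → end k e b ≡ hubG k i → end k e (not b) ≢ hubG k i
  far-end {e} {b} p q = Bool.not-¬ {b} refl (sym (end-injective k e (trans q (sym p))))

∈-avoidingEdges : ∀ k i e → AvoidsHub k i e → e ∈ avoidingEdges k i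
∈-avoidingEdges zero zero             (suc zero)       _ = here refl
∈-avoidingEdges zero (suc zero)       (suc (suc zero)) _ = here refl
∈-avoidingEdges zero (suc (suc zero)) zero             _ = here refl
∈-avoidingEdges zero zero             zero             e-avoids = ⊥-elim (e-avoids false refl)
∈-avoidingEdges zero zero             (suc (suc zero)) e-avoids = ⊥-elim (e-avoids false refl)
∈-avoidingEdges zero (suc zero)       zero             e-avoids = ⊥-elim (e-avoids true refl)
∈-avoidingEdges zero (suc zero)       (suc zero)       e-avoids = ⊥-elim (e-avoids false refl)
∈-avoidingEdges zero (suc (suc zero)) (suc zero)       e-avoids = ⊥-elim (e-avoids true refl)
∈-avoidingEdges zero (suc (suc zero)) (suc (suc zero)) e-avoids = ⊥-elim (e-avoids true refl)
∈-avoidingEdges (suc k) i (inj₁ e) e-avoids =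
  ∈-++⁺ˡ (∈-map⁺ inj₁ (∈-avoidingEdges k i e λ b p → e-avoids b (trans (end-old k e b) (cong inj₁ p))))
∈-avoidingEdges (suc k) i (inj₂ (e , b)) new-avoids with end k e (not b) ≟ᵛ hubG k i
... | yes far-at-h =
  ∈-++⁺ʳ (map inj₁ A) (∈-map⁺ inj₂ (∈-++⁺ʳ (map (_, false) A) (∈-++⁺ʳ (map (_, true) A)
    (subst (_∈ _) (cong (e ,_) (Bool.not-involutive b)) (∈-map⁺ _ (∈-hubIncidences k i e (not b) far-at-h))))))
  where A = avoidingEdges k i
∈-avoidingEdges (suc k) i (inj₂ (e , false)) new-avoids | no far-avoids =
  ∈-++⁺ʳ (map inj₁ (avoidingEdges k i)) (∈-map⁺ inj₂ (∈-++⁺ˡ (∈-map⁺ (_, false)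
    (∈-avoidingEdges k i e (AvoidsHub-both k i e false (new-avoids true ∘ cong inj₁) far-avoids)))))
∈-avoidingEdges (suc k) i (inj₂ (e , true)) new-avoids | no far-avoids =
  ∈-++⁺ʳ (map inj₁ A) (∈-map⁺ inj₂ (∈-++⁺ʳ (map (_, false) A) (∈-++⁺ˡ (∈-map⁺ (_, true)
    (∈-avoidingEdges k i e (AvoidsHub-both k i e true (new-avoids true ∘ cong inj₁) far-avoids))))))
  where A = avoidingEdges k i

avoidingEdges-unique : ∀ k i → Unique (avoidingEdges k i)
avoidingEdges-unique zero zero             = [] ∷ []
avoidingEdges-unique zero (suc zero)       = [] ∷ []
avoidingEdges-unique zero (suc (suc zero)) = [] ∷ []
avoidingEdges-unique (suc k) i =
  Unique.++⁺ (Unique.map⁺ inj₁-injective A-unique) (Unique.map⁺ inj₂-injective new-unique)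
             (Disjoint-map inj₁ inj₂ λ _ _ ())
  where
  A = avoidingEdges k i
  I = hubIncidences k i
  A-unique = avoidingEdges-unique k i
  opposite-injective : ∀ {p q : Edge k × Bool} → opposite p ≡ opposite q → p ≡ q
  opposite-injective {_ , _} {_ , _} eq = cong₂ _,_ (cong proj₁ eq) (Bool.not-injective (cong proj₂ eq))
  avoiding≢opposite : ∀ {e c p} → e ∈ A → p ∈ I → (e , c) ≢ opposite p
  avoiding≢opposite {p = e′ , b′} e∈A p∈I refl =
    All.lookup (avoidingEdges-sound k i) e∈A b′ (All.lookup (hubIncidences-sound k i) p∈I)
  new-unique : Unique (map (_, false) A ++ map (_, true) A ++ map opposite I)
  new-unique = Unique.++⁺ (Unique.map⁺ (cong proj₁) A-unique)
    (Unique.++⁺ (Unique.map⁺ (cong proj₁) A-unique) (Unique.map⁺ opposite-injective (hubIncidences-unique k i))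
                (Disjoint-map _ opposite avoiding≢opposite))
    (Disjoint-++ (Disjoint-map (_, false) (_, true) λ _ _ ()) (Disjoint-map _ opposite avoiding≢opposite))

length-avoidingEdges-suc : ∀ k i → length (avoidingEdges (suc k) i) ≡ 3 * length (avoidingEdges k i) + 2 ^ suc k
length-avoidingEdges-suc k i = begin
  length (map inj₁ A ++ map inj₂ (map (_, false) A ++ map (_, true) A ++ map opposite I))
    ≡⟨ length-map-++ inj₁ A _ ⟩
  a + length (map inj₂ (map (_, false) A ++ map (_, true) A ++ map opposite I))
    ≡⟨ cong (a +_) (length-map inj₂ (map (_, false) A ++ _)) ⟩
  a + length (map (_, false) A ++ map (_, true) A ++ map opposite I)
    ≡⟨ cong (a +_) (length-map-++ (_, false) A _) ⟩
  a + (a + length (map (_, true) A ++ map opposite I))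
    ≡⟨ cong (λ m → a + (a + m)) (length-map-++ (_, true) A _) ⟩
  a + (a + (a + length (map opposite I)))
    ≡⟨ cong (λ m → a + (a + (a + m))) (trans (length-map opposite I) (length-hubIncidences k i)) ⟩
  a + (a + (a + 2 ^ suc k))
    ≡⟨ three-copies a (2 ^ suc k) ⟩
  3 * a + 2 ^ suc k ∎
  where
  open ≡-Reasoning
  three-copies : ∀ a p → a + (a + (a + p)) ≡ 3 * a + p
  three-copies = solve-∀
  A = avoidingEdges k i
  I = hubIncidences k i
  a = length A

length-avoidingEdges : ∀ k i → length (avoidingEdges k i) + 2 ^ suc k ≡ 3 ^ suc k
length-avoidingEdges zero zero             = refl
length-avoidingEdges zero (suc zero)       = refl
length-avoidingEdges zero (suc (suc zero)) = refl
length-avoidingEdges (suc k) i = begin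
  length (avoidingEdges (suc k) i) + 2 * 2 ^ suc k  ≡⟨ cong (_+ 2 * 2 ^ suc k) (length-avoidingEdges-suc k i) ⟩
  3 * a + 2 ^ suc k + 2 * 2 ^ suc k                  ≡⟨ regroup a (2 ^ suc k) ⟩
  3 * (a + 2 ^ suc k)                                ≡⟨ cong (3 *_) (length-avoidingEdges k i) ⟩
  3 * 3 ^ suc k                                      ∎
  where
  open ≡-Reasoning
  regroup : ∀ a p → 3 * a + p + 2 * p ≡ 3 * (a + p)
  regroup = solve-∀
  a = length (avoidingEdges k i)

length-avoidingEdges-∸ : ∀ k i → suc (length (avoidingEdges k i)) ≡ 3 ^ suc k ∸ 2 ^ suc k + 1
length-avoidingEdges-∸ k i = begin
  suc a                        ≡⟨ +-comm 1 a ⟩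
  a + 1                        ≡⟨ cong (_+ 1) (m+n∸n≡m a (2 ^ suc k)) ⟨
  a + 2 ^ suc k ∸ 2 ^ suc k + 1 ≡⟨ cong (λ m → m ∸ 2 ^ suc k + 1) (length-avoidingEdges k i) ⟩
  3 ^ suc k ∸ 2 ^ suc k + 1    ∎
  where
  open ≡-Reasoning
  a = length (avoidingEdges k i)

edgeOf : ∀ {k} → Vert (suc k) → Edge k
edgeOf {k} (inj₁ v) = incidentEdge k v
edgeOf     (inj₂ e) = e

hubIndependent-length-≤ : ∀ k i S → IsIndependentSet (suc (suc k)) S → hubG (suc k) i ∈ S →
  length S ≤ suc (length (avoidingEdges k i))
hubIndependent-length-≤ k i S (S-unique , S-independent) h∈S = begin
  length S              ≡⟨ length-map edgeOf S ⟨
  length (map edgeOf S) ≤⟨ Unique-⊆⇒length-≤ (Unique-map⁺-injectiveOn edgeOf edgeOf-injective S-unique) edgeOf-⊆ ⟩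
  length (incidentEdge k h ∷ avoidingEdges k i) ∎
  where
  open ≤-Reasoning
  h = hubG k i
  nonadjacent : ∀ {x y} → x ∈ S → y ∈ S → ¬ AdjG (suc k) x y
  nonadjacent = S-independent _ _
  edgeOf-injective : ∀ {x y} → x ∈ S → y ∈ S → edgeOf x ≡ edgeOf y → x ≡ y
  edgeOf-injective {inj₁ _} {inj₁ _} _   _   p    = cong inj₁ (incidentEdge-injective k p)
  edgeOf-injective {inj₂ _} {inj₂ _} _   _   p    = cong inj₂ p
  edgeOf-injective {inj₁ v} {inj₂ _} v∈S e∈S refl = ⊥-elim (nonadjacent e∈S v∈S (AdjG-new-incidentEdge k v))
  edgeOf-injective {inj₂ _} {inj₁ v} e∈S v∈S refl = ⊥-elim (nonadjacent e∈S v∈S (AdjG-new-incidentEdge k v))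
  edgeOf-∈ : ∀ s → s ∈ S → edgeOf s ∈ incidentEdge k h ∷ avoidingEdges k i
  edgeOf-∈ (inj₂ e) e∈S = there (∈-avoidingEdges k i e λ b p →
    nonadjacent e∈S h∈S (subst (λ z → AdjG (suc k) (inj₂ e) (inj₁ z)) p (AdjG-new-end k e b)))
  edgeOf-∈ (inj₁ v) v∈S with v ≟ᵛ h
  ... | yes refl = here refl
  ... | no v≢h   = there (∈-avoidingEdges k i (incidentEdge k v) avoids)
    where
    avoids : AvoidsHub k i (incidentEdge k v)
    avoids c p with incidentEdge-end k v
    ... | c′ , q with ends-adjacent k (incidentEdge k v) c c′
    ... | inj₁ refl = v≢h (trans (sym q) p)
    ... | inj₂ adj  = nonadjacent v∈S h∈S (AdjG-old k (subst₂ (AdjG k) q p adj))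
  edgeOf-⊆ : map edgeOf S ⊆ incidentEdge k h ∷ avoidingEdges k i
  edgeOf-⊆ x∈ with ∈-map⁻ edgeOf x∈
  ... | s , s∈S , refl = edgeOf-∈ s s∈S

hubAndAvoiding : ∀ k → Fin 3 → List (Vert (suc k))
hubAndAvoiding k i = hubG (suc k) i ∷ map inj₂ (avoidingEdges k i)

hubAndAvoiding-independent : ∀ k i → IsIndependentSet (suc (suc k)) (hubAndAvoiding k i)
hubAndAvoiding-independent k i = unique , independent
  where
  A = avoidingEdges k i
  unique : Unique (hubAndAvoiding k i)
  unique = All.map⁺ (All.tabulate λ _ ()) ∷ Unique.map⁺ inj₂-injective (avoidingEdges-unique k i)
  ¬AdjG-new : ∀ {x e} → x ∈ hubAndAvoiding k i → e ∈ A → ¬ AdjG (suc k) x (inj₂ e)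
  ¬AdjG-new {x} {e} x∈ e∈A adj with AdjG-new⇒end k e x adj | x∈
  ... | b , refl | here p = All.lookup (avoidingEdges-sound k i) e∈A b (inj₁-injective p)
  ... | b , refl | there x∈′ with ∈-map⁻ inj₂ x∈′
  ...   | _ , _ , ()
  independent : ∀ x y → x ∈ hubAndAvoiding k i → y ∈ hubAndAvoiding k i → ¬ AdjG (suc k) x y
  independent x y x∈ (there y∈) adj with ∈-map⁻ inj₂ y∈
  ... | e , e∈A , refl = ¬AdjG-new x∈ e∈A adj
  independent x y (here refl) (here refl) adj = AdjG-irrefl (suc k) x adj
  independent x y (there x∈) (here refl) adj with ∈-map⁻ inj₂ x∈
  ... | e , e∈A , refl = ¬AdjG-new (here refl) e∈A (AdjG-sym (suc k) adj)

hubAndAvoiding-oneHub : ∀ k i → ExactlyOneHub (suc (suc k)) (hubAndAvoiding k i)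
hubAndAvoiding-oneHub k i = i , here refl , only-i
  where
  only-i : ∀ j → hubG (suc k) j ∈ hubAndAvoiding k i → j ≡ i
  only-i j (here p) = hubG-injective (suc k) p
  only-i j (there h∈) with ∈-map⁻ inj₂ h∈
  ... | _ , _ , ()

mainTheorem5 : ∀ (n : ℕ) → 2 ≤ n →
    IsMaxOneHubIndep n ((3 ^ (n ∸ 1) ∸ 2 ^ (n ∸ 1)) + 1)
mainTheorem5 zero          ()
mainTheorem5 (suc zero)    (s≤s ())
mainTheorem5 (suc (suc k)) _ = (S , hubAndAvoiding-independent k zero , hubAndAvoiding-oneHub k zero , |S|) , maximal
  where
  S = hubAndAvoiding k zero
  |S| : length S ≡ 3 ^ suc k ∸ 2 ^ suc k + 1
  |S| = trans (cong suc (length-map inj₂ (avoidingEdges k zero))) (length-avoidingEdges-∸ k zero)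
  maximal : ∀ T → IsIndependentSet (suc (suc k)) T → ExactlyOneHub (suc (suc k)) T →
            length T ≤ 3 ^ suc k ∸ 2 ^ suc k + 1
  maximal T T-independent (i , h∈T , _) =
    ≤-trans (hubIndependent-length-≤ k i T T-independent h∈T) (≤-reflexive (length-avoidingEdges-∸ k i))
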